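{- The simple involutions that avoid $2341$ are exactly the permutation $5274163$ together with the simple involutions that avoid $123$.
   Context: A permutation $\pi$ contains $\sigma$ if $\pi$ has a subsequence order isomorphic to $\sigma$; otherwise it avoids $\sigma$. An involution is a permutation equal to its own inverse. An interval of a permutation $\pi$ of length $n$ is a set of contiguous positions whose set of values is also contiguous; intervals of size $0$, $1$ and $n$ are trivial. A permutation of length at least $2$ is simple if it has no nontrivial intervals. Permutations are written in one-line notation. -}

module Defs where

open import Data.Nat using (ℕ; zero; suc; _+_; _≤_; _<_)
open import Data.Fin using (Fin; toℕ; #_; zero)
import Data.Fin as Fin
open import Data.List using (List; map; allFin; _∷_; [])
open import Data.Vec using (Vec; lookup; _∷_; [])
open import Data.Product using (Σ; ∃; _×_; _,_; proj₁)
open import Function.Base using (_∘_)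
open import Function.Definitions using (Injective)
open import Relation.Binary.PropositionalEquality using (_≡_; refl; sym; trans; cong)
open import Relation.Nullary using (¬_)
open import Data.Empty using (⊥)
open import Function.Bundles using (_⇔_)

-- A permutation of length n: an injective (hence bijective) map Fin n → Fin n,
-- position i (0-based) ↦ value π i (0-based).
Perm : ℕ → Set
Perm n = Σ (Fin n → Fin n) (Injective _≡_ _≡_)

_⟨_⟩ : ∀ {n} → Perm n → Fin n → Fin n
π ⟨ i ⟩ = proj₁ π i

oneLine : ∀ {n} → Perm n → List ℕ
oneLine {n} π = map (λ i → suc (toℕ (π ⟨ i ⟩))) (allFin n)

Contains : ∀ {n k} → Perm n → Perm k → Set
Contains {n} {k} π σ =
  Σ (Fin k → Fin n) λ f →
    (∀ (i j : Fin k) → toℕ i < toℕ j → toℕ (f i) < toℕ (f j)) ×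
    (∀ (i j : Fin k) → (toℕ (σ ⟨ i ⟩) < toℕ (σ ⟨ j ⟩)) ⇔ (toℕ (π ⟨ f i ⟩) < toℕ (π ⟨ f j ⟩)))

Avoids : ∀ {n k} → Perm n → Perm k → Set
Avoids π σ = ¬ Contains π σ

IsInvolution : ∀ {n} → Perm n → Set
IsInvolution π = ∀ i → π ⟨ π ⟨ i ⟩ ⟩ ≡ i

IsInterval : ∀ {n} → Perm n → ℕ → ℕ → Set
IsInterval {n} π a m =
  (a + m ≤ n) ×
  Σ ℕ λ b →
    (∀ (p : Fin n) → a ≤ toℕ p → toℕ p < a + m →
       b ≤ toℕ (π ⟨ p ⟩) × toℕ (π ⟨ p ⟩) < b + m) ×
    (∀ (v : ℕ) → b ≤ v → v < b + m →
       Σ (Fin n) λ p → (a ≤ toℕ p) × (toℕ p < a + m) × (toℕ (π ⟨ p ⟩) ≡ v))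

IsSimple : ∀ {n} → Perm n → Set
IsSimple {n} π =
  (2 ≤ n) ×
  (∀ (a m : ℕ) → IsInterval π a m → 2 ≤ m → m < n → ⊥)

inj-from-linv : ∀ {n} (f g : Fin n → Fin n) → (∀ x → g (f x) ≡ x) → Injective _≡_ _≡_ f
inj-from-linv f g gf {x} {y} e = trans (sym (gf x)) (trans (cong g e) (gf y))

p2341 : Fin 4 → Fin 4
p2341 zero = # 1
p2341 (Fin.suc zero) = # 2
p2341 (Fin.suc (Fin.suc zero)) = # 3
p2341 (Fin.suc (Fin.suc (Fin.suc zero))) = # 0

p2341⁻¹ : Fin 4 → Fin 4
p2341⁻¹ zero = # 3
p2341⁻¹ (Fin.suc zero) = # 0
p2341⁻¹ (Fin.suc (Fin.suc zero)) = # 1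
p2341⁻¹ (Fin.suc (Fin.suc (Fin.suc zero))) = # 2

σ2341 : Perm 4
σ2341 = p2341 , inj-from-linv p2341 p2341⁻¹ linv
  where
  linv : ∀ x → p2341⁻¹ (p2341 x) ≡ x
  linv zero = refl
  linv (Fin.suc zero) = refl
  linv (Fin.suc (Fin.suc zero)) = refl
  linv (Fin.suc (Fin.suc (Fin.suc zero))) = refl

σ123 : Perm 3
σ123 = (λ x → x) , (λ e → e)

-- Let π be a simple involution of length N + 1 avoiding 2341 (hence also its inverse 4123)
-- and containing 123, and put first = π(0), last = π(N). Simplicity rules out first, last
-- ∈ {0, N}, and if first < last then, with M the largest value at a position ≤ first,
-- avoiding 2341 makes {0, …, M} a nontrivial interval; so last < first. As π swaps 0 ↔ first
-- and N ↔ last, it permutes the positions of the blocks A = (0, last), B = (last, first)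
-- and C = (first, N), and the occurrence of 123 puts one entry in each block. Pattern
-- avoidance then shows that no block is mapped into another, so each block is closed under
-- π; a closed block with two positions would be a nontrivial interval, hence each block is
-- a single position and π = 5274163. Conversely 123 occurs in 2341, and the three
-- properties of 5274163 are checked by decision procedures.

module Submission where

open import Defs
open import Data.Nat using (ℕ; zero; suc; pred; _+_; _≤_; _<_; z≤n; s≤s; z<s; _<?_; _≤?_; _≟_; >-nonZero)
open import Data.Nat.Properties
open import Data.Fin using (Fin; toℕ; fromℕ<) renaming (zero to fz; suc to fs)
open import Data.Fin.Properties using (toℕ-fromℕ<; fromℕ<-toℕ; toℕ<n; toℕ-injective)
open import Data.List using (_∷_; []; length; tabulate)
open import Data.List.Properties using (∷-injectiveˡ; ∷-injectiveʳ; length-tabulate; map-tabulate; tabulate-cong)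
open import Data.Product using (Σ; ∃; _×_; _,_; proj₁; proj₂)
open import Data.Sum using (_⊎_; inj₁; inj₂)
open import Data.Empty using (⊥; ⊥-elim)
open import Relation.Nullary using (¬_; yes; no; Dec)
open import Relation.Nullary.Decidable using (_×-dec_; _→-dec_; ¬?; toWitness; toWitnessFalse)
open import Relation.Binary.PropositionalEquality
open import Relation.Binary.Definitions using (tri<; tri≈; tri>)
open import Function.Base using (_∘_)
open import Function.Bundles using (_⇔_; mk⇔; Equivalence)

_≡<_ : ∀ {a b c : ℕ} → a ≡ b → b < c → a < c
refl ≡< h = h

_<≡_ : ∀ {a b c : ℕ} → a < b → c ≡ b → a < c
h <≡ refl = h

infixr 5 _≡<_
infixl 5 _<≡_

<-pred-≢ : ∀ {a b} → a < suc b → a ≢ b → a < b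
<-pred-≢ a<1+b a≢b = ≤∧≢⇒< (m<1+n⇒m≤n a<1+b) a≢b

squeeze : ∀ {a v} → a < v → v < suc (suc a) → v ≡ suc a
squeeze a<v v<2+a = ≤-antisym (m<1+n⇒m≤n v<2+a) a<v

≮1+⇒≡1+ : ∀ {a x} → a < x → ¬ (suc a < x) → x ≡ suc a
≮1+⇒≡1+ a<x 1+a≮x = ≤-antisym (≮⇒≥ 1+a≮x) a<x

+2-cases : ∀ {a x} → a ≤ x → x < a + 2 → x ≡ a ⊎ x ≡ suc a
+2-cases {a} {x} a≤x x<a+2 with m≤n⇒m<n∨m≡n (m<1+n⇒m≤n (subst (x <_) (+-comm a 2) x<a+2))
... | inj₁ x<1+a = inj₁ (≤-antisym (m<1+n⇒m≤n x<1+a) a≤x)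
... | inj₂ x≡1+a = inj₂ x≡1+a

<-chain : ∀ {k} (h : ℕ → ℕ) → (∀ {x} → suc x < k → h x < h (suc x)) →
          ∀ {x y} → x < y → y < k → h x < h y
<-chain h step {x} {suc y} x<1+y 1+y<k with m<1+n⇒m<n∨m≡n x<1+y
... | inj₁ x<y = <-trans (<-chain h step x<y (<-trans (n<1+n y) 1+y<k)) (step 1+y<k)
... | inj₂ refl = step 1+y<k

argmax : (f : ℕ → ℕ) (k : ℕ) → ∃ λ i → i ≤ k × (∀ {x} → x ≤ k → f x ≤ f i)
argmax f zero = 0 , z≤n , λ { z≤n → ≤-refl }
argmax f (suc k) with argmax f k
... | i , i≤k , max with f (suc k) ≤? f i
...   | yes fk≤fi = i , m≤n⇒m≤1+n i≤k , bound
  where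
  bound : ∀ {x} → x ≤ suc k → f x ≤ f i
  bound x≤1+k with m≤n⇒m<n∨m≡n x≤1+k
  ... | inj₁ x<1+k = max (m<1+n⇒m≤n x<1+k)
  ... | inj₂ refl = fk≤fi
...   | no fk≰fi = suc k , ≤-refl , bound
  where
  bound : ∀ {x} → x ≤ suc k → f x ≤ f (suc k)
  bound x≤1+k with m≤n⇒m<n∨m≡n x≤1+k
  ... | inj₁ x<1+k = ≤-trans (max (m<1+n⇒m≤n x<1+k)) (<⇒≤ (≰⇒> fk≰fi))
  ... | inj₂ refl = ≤-refl

tabulate-injective : ∀ {a} {A : Set a} {n} {f g : Fin n → A} →
                     tabulate f ≡ tabulate g → ∀ i → f i ≡ g i
tabulate-injective {n = suc n} eq fz = ∷-injectiveˡ eq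
tabulate-injective {n = suc n} eq (fs i) = tabulate-injective (∷-injectiveʳ eq) i

-- Occurrences of 123 and 2341 at positions below n of f, quantified from the last
-- position down so that anyUpTo? decides them.
Occurs123 : (ℕ → ℕ) → ℕ → Set
Occurs123 f n = ∃ λ k → k < n × ∃ λ j → j < k × ∃ λ i → i < j × f i < f j × f j < f k

Occurs2341 : (ℕ → ℕ) → ℕ → Set
Occurs2341 f n =
  ∃ λ l → l < n × ∃ λ k → k < l × ∃ λ j → j < k × ∃ λ i → i < j ×
  f l < f i × f i < f j × f j < f k

occurs123? : ∀ f n → Dec (Occurs123 f n)
occurs123? f = anyUpTo? λ k → anyUpTo? (λ j → anyUpTo? (λ i → (f i <? f j) ×-dec (f j <? f k)) j) k

occurs2341? : ∀ f n → Dec (Occurs2341 f n)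
occurs2341? f = anyUpTo? λ l → anyUpTo? (λ k → anyUpTo? (λ j → anyUpTo? (λ i →
  (f l <? f i) ×-dec ((f i <? f j) ×-dec (f j <? f k))) j) k) l

occurs2341⇒occurs123 : ∀ {f n} → Occurs2341 f n → Occurs123 f n
occurs2341⇒occurs123 (l , l<n , k , k<l , j , j<k , i , i<j , _ , fi<fj , fj<fk) =
  k , <-trans k<l l<n , j , j<k , i , i<j , fi<fj , fj<fk

occurs2341-cong : ∀ {f g n} → (∀ {x} → x < n → f x ≡ g x) → Occurs2341 f n → Occurs2341 g n
occurs2341-cong {n = n} f≡g (l , l<n , k , k<l , j , j<k , i , i<j , fl<fi , fi<fj , fj<fk) =
  l , l<n , k , k<l , j , j<k , i , i<j ,
  subst₂ _<_ (f≡g l<n) (f≡g i<n) fl<fi , subst₂ _<_ (f≡g i<n) (f≡g j<n) fi<fj , subst₂ _<_ (f≡g j<n) (f≡g k<n) fj<fk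
  where
  k<n : k < n
  k<n = <-trans k<l l<n
  j<n : j < n
  j<n = <-trans j<k k<n
  i<n : i < n
  i<n = <-trans i<j j<n

module Values {n : ℕ} (π : Perm n) where

  -- π on ℕ, with junk value 0 outside the positions 0 … n-1.
  val : ℕ → ℕ
  val x with x <? n
  ... | yes x<n = toℕ (π ⟨ fromℕ< x<n ⟩)
  ... | no _ = 0

  val-toℕ : ∀ i → val (toℕ i) ≡ toℕ (π ⟨ i ⟩)
  val-toℕ i with toℕ i <? n
  ... | yes i<n = cong (λ j → toℕ (π ⟨ j ⟩)) (fromℕ<-toℕ i i<n)
  ... | no i≮n = ⊥-elim (i≮n (toℕ<n i))

  val-fromℕ< : ∀ {x} (x<n : x < n) → toℕ (π ⟨ fromℕ< x<n ⟩) ≡ val x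
  val-fromℕ< x<n = trans (sym (val-toℕ (fromℕ< x<n))) (cong val (toℕ-fromℕ< x<n))

  val<n : ∀ {x} → x < n → val x < n
  val<n x<n = subst (_< n) (val-fromℕ< x<n) (toℕ<n _)

  -- w lists the values of the occurrence in increasing order.
  contains-at : ∀ {k} (σ : Perm k) (pos w : ℕ → ℕ) → (∀ x → pos x < n) →
                (∀ {x} → suc x < k → pos x < pos (suc x)) →
                (∀ {x} → suc x < k → w x < w (suc x)) →
                (∀ i → val (pos (toℕ i)) ≡ w (toℕ (σ ⟨ i ⟩))) →
                Contains π σ
  contains-at σ pos w pos<n pos-step w-step pos↦w = f , f-mono , λ x y → mk⇔ (ordered x y) (reflect x y)
    where
    f : _ → Fin n
    f x = fromℕ< (pos<n (toℕ x))
    f-mono : ∀ x y → toℕ x < toℕ y → toℕ (f x) < toℕ (f y)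
    f-mono x y x<y = subst₂ _<_ (sym (toℕ-fromℕ< (pos<n (toℕ x)))) (sym (toℕ-fromℕ< (pos<n (toℕ y))))
                       (<-chain pos pos-step x<y (toℕ<n y))
    value : ∀ x → toℕ (π ⟨ f x ⟩) ≡ w (toℕ (σ ⟨ x ⟩))
    value x = trans (val-fromℕ< (pos<n (toℕ x))) (pos↦w x)
    ordered : ∀ x y → toℕ (σ ⟨ x ⟩) < toℕ (σ ⟨ y ⟩) → toℕ (π ⟨ f x ⟩) < toℕ (π ⟨ f y ⟩)
    ordered x y σx<σy = subst₂ _<_ (sym (value x)) (sym (value y)) (<-chain w w-step σx<σy (toℕ<n (σ ⟨ y ⟩)))
    reflect : ∀ x y → toℕ (π ⟨ f x ⟩) < toℕ (π ⟨ f y ⟩) → toℕ (σ ⟨ x ⟩) < toℕ (σ ⟨ y ⟩)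
    reflect x y πx<πy with <-cmp (toℕ (σ ⟨ x ⟩)) (toℕ (σ ⟨ y ⟩))
    ... | tri< σx<σy _ _ = σx<σy
    ... | tri≈ _ σx≡σy _ with proj₂ σ (toℕ-injective σx≡σy)
    ...   | refl = ⊥-elim (<-irrefl refl πx<πy)
    reflect x y πx<πy | tri> _ _ σy<σx = ⊥-elim (<-asym πx<πy (ordered y x σy<σx))

  ordered-values : ∀ {k} {σ : Perm k} ((f , _ , iso) : Contains π σ) → ∀ x y →
                   toℕ (σ ⟨ x ⟩) < toℕ (σ ⟨ y ⟩) → val (toℕ (f x)) < val (toℕ (f y))
  ordered-values (f , _ , iso) x y σx<σy =
    subst₂ _<_ (sym (val-toℕ (f x))) (sym (val-toℕ (f y))) (Equivalence.to (iso x y) σx<σy)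

  contains123⇔ : Contains π σ123 ⇔ Occurs123 val n
  contains123⇔ = mk⇔ to from
    where
    to : Contains π σ123 → Occurs123 val n
    to c@(f , mono , _) =
      toℕ (f (fs (fs fz))) , toℕ<n _ ,
      toℕ (f (fs fz)) , mono (fs fz) (fs (fs fz)) (s≤s (s≤s z≤n)) ,
      toℕ (f fz) , mono fz (fs fz) (s≤s z≤n) ,
      ordered-values {σ = σ123} c fz (fs fz) (s≤s z≤n) ,
      ordered-values {σ = σ123} c (fs fz) (fs (fs fz)) (s≤s (s≤s z≤n))
    from : Occurs123 val n → Contains π σ123
    from (k , k<n , j , j<k , i , i<j , vi<vj , vj<vk) =
      contains-at σ123 pos (λ x → val (pos x)) pos<n step value-step (λ _ → refl)
      where
      pos : ℕ → ℕ
      pos 0 = i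
      pos 1 = j
      pos _ = k
      pos<n : ∀ x → pos x < n
      pos<n 0 = <-trans i<j (<-trans j<k k<n)
      pos<n 1 = <-trans j<k k<n
      pos<n (suc (suc _)) = k<n
      step : ∀ {x} → suc x < 3 → pos x < pos (suc x)
      step {0} _ = i<j
      step {1} _ = j<k
      step {suc (suc _)} (s≤s (s≤s (s≤s ())))
      value-step : ∀ {x} → suc x < 3 → val (pos x) < val (pos (suc x))
      value-step {0} _ = vi<vj
      value-step {1} _ = vj<vk
      value-step {suc (suc _)} (s≤s (s≤s (s≤s ())))

  contains2341⇔ : Contains π σ2341 ⇔ Occurs2341 val n
  contains2341⇔ = mk⇔ to from
    where
    to : Contains π σ2341 → Occurs2341 val n
    to c@(f , mono , _) =
      toℕ (f (fs (fs (fs fz)))) , toℕ<n _ ,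
      toℕ (f (fs (fs fz))) , mono (fs (fs fz)) (fs (fs (fs fz))) (s≤s (s≤s (s≤s z≤n))) ,
      toℕ (f (fs fz)) , mono (fs fz) (fs (fs fz)) (s≤s (s≤s z≤n)) ,
      toℕ (f fz) , mono fz (fs fz) (s≤s z≤n) ,
      ordered-values {σ = σ2341} c (fs (fs (fs fz))) fz (s≤s z≤n) ,
      ordered-values {σ = σ2341} c fz (fs fz) (s≤s (s≤s z≤n)) ,
      ordered-values {σ = σ2341} c (fs fz) (fs (fs fz)) (s≤s (s≤s (s≤s z≤n)))
    from : Occurs2341 val n → Contains π σ2341
    from (l , l<n , k , k<l , j , j<k , i , i<j , vl<vi , vi<vj , vj<vk) =
      contains-at σ2341 pos w pos<n step w-step pos↦w
      where
      pos w : ℕ → ℕ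
      pos 0 = i
      pos 1 = j
      pos 2 = k
      pos _ = l
      w 0 = val l
      w 1 = val i
      w 2 = val j
      w _ = val k
      k<n : k < n
      k<n = <-trans k<l l<n
      j<n : j < n
      j<n = <-trans j<k k<n
      pos<n : ∀ x → pos x < n
      pos<n 0 = <-trans i<j j<n
      pos<n 1 = j<n
      pos<n 2 = k<n
      pos<n (suc (suc (suc _))) = l<n
      step : ∀ {x} → suc x < 4 → pos x < pos (suc x)
      step {0} _ = i<j
      step {1} _ = j<k
      step {2} _ = k<l
      step {suc (suc (suc _))} (s≤s (s≤s (s≤s (s≤s ()))))
      w-step : ∀ {x} → suc x < 4 → w x < w (suc x)
      w-step {0} _ = vl<vi
      w-step {1} _ = vi<vj
      w-step {2} _ = vj<vk
      w-step {suc (suc (suc _))} (s≤s (s≤s (s≤s (s≤s ()))))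
      pos↦w : ∀ x → val (pos (toℕ x)) ≡ w (toℕ (σ2341 ⟨ x ⟩))
      pos↦w fz = refl
      pos↦w (fs fz) = refl
      pos↦w (fs (fs fz)) = refl
      pos↦w (fs (fs (fs fz))) = refl

  oneLine-tabulate : oneLine π ≡ tabulate (λ i → suc (toℕ (π ⟨ i ⟩)))
  oneLine-tabulate = map-tabulate (λ i → i) _

  length-oneLine : length (oneLine π) ≡ n
  length-oneLine = trans (cong length oneLine-tabulate) (length-tabulate _)

  interval-values : ∀ {a m} → IsInterval π a m →
                    ∃ λ b → ∀ {x} → x < a + m → a ≤ x → b ≤ val x × val x < b + m
  interval-values {a} {m} (a+m≤n , b , positions , _) = b , inside
    where
    inside : ∀ {x} → x < a + m → a ≤ x → b ≤ val x × val x < b + m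
    inside {x} x<a+m a≤x = subst (λ v → b ≤ v × v < b + m) (val-fromℕ< x<n)
      (positions (fromℕ< x<n) (subst (a ≤_) (sym (toℕ-fromℕ< x<n)) a≤x) (subst (_< a + m) (sym (toℕ-fromℕ< x<n)) x<a+m))
      where x<n = <-≤-trans x<a+m a+m≤n

avoids123⇒avoids2341 : ∀ {n} (π : Perm n) → Avoids π σ123 → Avoids π σ2341
avoids123⇒avoids2341 π av123 =
  av123 ∘ Equivalence.from contains123⇔ ∘ occurs2341⇒occurs123 ∘ Equivalence.to contains2341⇔
  where open Values π

module Involution {n : ℕ} (π : Perm n) (inv : IsInvolution π) where
  open Values π public

  val-involutive : ∀ {x} → x < n → val (val x) ≡ x
  val-involutive {x} x<n = begin
    val (val x)                            ≡⟨ cong val (sym (val-fromℕ< x<n)) ⟩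
    val (toℕ (π ⟨ fromℕ< x<n ⟩))           ≡⟨ val-toℕ (π ⟨ fromℕ< x<n ⟩) ⟩
    toℕ (π ⟨ π ⟨ fromℕ< x<n ⟩ ⟩)           ≡⟨ cong toℕ (inv (fromℕ< x<n)) ⟩
    toℕ (fromℕ< x<n)                       ≡⟨ toℕ-fromℕ< x<n ⟩
    x                                      ∎
    where open ≡-Reasoning

  val-swap : ∀ {x v} → x < n → val x ≡ v → val v ≡ x
  val-swap x<n refl = val-involutive x<n

  val-injective : ∀ {x y} → x < n → y < n → val x ≡ val y → x ≡ y
  val-injective x<n y<n vx≡vy = trans (sym (val-involutive x<n)) (val-swap y<n (sym vx≡vy))

  isInterval-of-blocks : ∀ a m b → a + m ≤ n → b + m ≤ n →
    (∀ x → a ≤ x → x < a + m → b ≤ val x × val x < b + m) →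
    (∀ y → b ≤ y → y < b + m → a ≤ val y × val y < a + m) →
    IsInterval π a m
  isInterval-of-blocks a m b a+m≤n b+m≤n a↦b b↦a = a+m≤n , b , positions , values
    where
    positions : ∀ (p : Fin n) → a ≤ toℕ p → toℕ p < a + m →
                b ≤ toℕ (π ⟨ p ⟩) × toℕ (π ⟨ p ⟩) < b + m
    positions p a≤p p<a+m rewrite sym (val-toℕ p) = a↦b (toℕ p) a≤p p<a+m
    values : ∀ (v : ℕ) → b ≤ v → v < b + m →
             Σ (Fin n) λ p → (a ≤ toℕ p) × (toℕ p < a + m) × (toℕ (π ⟨ p ⟩) ≡ v)
    values v b≤v v<b+m = π ⟨ fromℕ< v<n ⟩ ,
      subst (a ≤_) (sym (val-fromℕ< v<n)) (proj₁ (b↦a v b≤v v<b+m)) ,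
      subst (_< a + m) (sym (val-fromℕ< v<n)) (proj₂ (b↦a v b≤v v<b+m)) ,
      trans (cong toℕ (inv (fromℕ< v<n))) (toℕ-fromℕ< v<n)
      where
      v<n : v < n
      v<n = <-≤-trans v<b+m b+m≤n

module Avoiding {n : ℕ} (π : Perm n) (inv : IsInvolution π) (av : Avoids π σ2341) where
  open Involution π inv public

  no-2341 : ∀ {i j k l} → i < j → j < k → k < l → l < n →
            val l < val i → val i < val j → val j < val k → ⊥
  no-2341 {i} {j} {k} {l} i<j j<k k<l l<n vl<vi vi<vj vj<vk =
    av (Equivalence.from contains2341⇔ (l , l<n , k , k<l , j , j<k , i , i<j , vl<vi , vi<vj , vj<vk))

  -- 4123 is the inverse of 2341.
  no-4123 : ∀ {i j k l} → i < j → j < k → k < l → l < n →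
            val j < val k → val k < val l → val l < val i → ⊥
  no-4123 {i} {j} {k} {l} i<j j<k k<l l<n vj<vk vk<vl vl<vi =
    no-2341 vj<vk vk<vl vl<vi (val<n i<n)
      (subst₂ _<_ (sym (val-involutive i<n)) (sym (val-involutive j<n)) i<j)
      (subst₂ _<_ (sym (val-involutive j<n)) (sym (val-involutive k<n)) j<k)
      (subst₂ _<_ (sym (val-involutive k<n)) (sym (val-involutive l<n)) k<l)
    where
    k<n : k < n
    k<n = <-trans k<l l<n
    j<n : j < n
    j<n = <-trans j<k k<n
    i<n : i < n
    i<n = <-trans i<j j<n

module SimpleAvoider {N : ℕ} (π : Perm (suc N)) (inv : IsInvolution π) (av : Avoids π σ2341)
                     (simp : IsSimple π) (2≤N : 2 ≤ N) where
  open Avoiding π inv av public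

  n : ℕ
  n = suc N

  N<n : N < n
  N<n = n<1+n N

  1<n : 1 < n
  1<n = s≤s (≤-trans (s≤s z≤n) 2≤N)

  interval-absurd : ∀ a m b → a + m ≤ n → b + m ≤ n → 2 ≤ m → m < n →
    (∀ x → a ≤ x → x < a + m → b ≤ val x × val x < b + m) →
    (∀ y → b ≤ y → y < b + m → a ≤ val y × val y < a + m) → ⊥
  interval-absurd a m b a+m≤n b+m≤n 2≤m m<n a↦b b↦a =
    proj₂ simp a m (isInterval-of-blocks a m b a+m≤n b+m≤n a↦b b↦a) 2≤m m<n

  first last : ℕ
  first = val 0
  last = val N

  first<n : first < n
  first<n = val<n z<s

  last<n : last < n
  last<n = val<n N<n

  val-first : val first ≡ 0
  val-first = val-swap z<s refl

  val-last : val last ≡ N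
  val-last = val-swap N<n refl

  val-≢ : ∀ {x d c} → x < n → d < n → val d ≡ c → x ≢ d → val x ≢ c
  val-≢ x<n d<n vd≡c x≢d vx≡c = x≢d (val-injective x<n d<n (trans vx≡c (sym vd≡c)))

  no-adjacent-swap : ∀ a b → suc (suc a) ≤ n → suc (suc b) ≤ n → val a ≡ suc b → val (suc a) ≡ b → ⊥
  no-adjacent-swap a b 2+a≤n 2+b≤n va vsa =
    interval-absurd a 2 b (subst (_≤ n) (+-comm 2 a) 2+a≤n) (subst (_≤ n) (+-comm 2 b) 2+b≤n)
      ≤-refl (s≤s 2≤N) (swapped a b va vsa) (swapped b a vb vsb)
    where
    vb : val b ≡ suc a
    vb = val-swap 2+a≤n vsa
    vsb : val (suc b) ≡ a
    vsb = val-swap (≤-trans (n≤1+n _) 2+a≤n) va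
    swapped : ∀ a b → val a ≡ suc b → val (suc a) ≡ b →
              ∀ x → a ≤ x → x < a + 2 → b ≤ val x × val x < b + 2
    swapped a b va vsa x a≤x x<a+2 with +2-cases a≤x x<a+2
    ... | inj₁ refl = subst (b ≤_) (sym va) (n≤1+n b) , subst (_< b + 2) (sym va) (subst (suc b <_) (+-comm 2 b) ≤-refl)
    ... | inj₂ refl = subst (b ≤_) (sym vsa) ≤-refl , subst (_< b + 2) (sym vsa) (m<m+n b z<s)

  closed-block-absurd : ∀ lo hi → hi ≤ N → (∀ {x} → lo < x × x < hi → lo < val x × val x < hi) →
                        ∀ {x y} → lo < x → x < y → y < hi → ⊥
  closed-block-absurd lo hi hi≤N closed {x} {y} lo<x x<y y<hi with m≤n⇒∃[o]m+o≡n (<-trans lo<x (<-trans x<y y<hi))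
  ... | m , lo+m≡hi = interval-absurd (suc lo) m (suc lo) fits fits 2≤m m<n inside inside
    where
    fits : suc lo + m ≤ n
    fits = subst (_≤ n) (sym lo+m≡hi) (≤-trans hi≤N (n≤1+n N))
    2≤m : 2 ≤ m
    2≤m = +-cancelˡ-≤ (suc lo) 2 m (subst (suc lo + 2 ≤_) (sym lo+m≡hi)
           (subst (_≤ hi) (+-comm 2 (suc lo)) (≤-trans (s≤s (≤-trans (s≤s lo<x) x<y)) y<hi)))
    m<n : m < n
    m<n = s≤s (≤-trans (m≤n+m m (suc lo)) (subst (_≤ N) (sym lo+m≡hi) hi≤N))
    inside : ∀ z → suc lo ≤ z → z < suc lo + m → suc lo ≤ val z × val z < suc lo + m
    inside z lo<z z<lo+m with closed (lo<z , subst (z <_) lo+m≡hi z<lo+m)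
    ... | lo<vz , vz<hi = lo<vz , subst (val z <_) (sym lo+m≡hi) vz<hi

  first≢0 : first ≢ 0
  first≢0 first≡0 = interval-absurd 1 N 1 ≤-refl ≤-refl 2≤N N<n inner inner
    where
    inner : ∀ x → 1 ≤ x → x < 1 + N → 1 ≤ val x × val x < 1 + N
    inner x 1≤x x<n = n≢0⇒n>0 (val-≢ x<n z<s first≡0 (λ x≡0 → <⇒≢ 1≤x (sym x≡0))) , val<n x<n

  first≢N : first ≢ N
  first≢N first≡N = interval-absurd 1 N 0 ≤-refl (n≤1+n N) 2≤N N<n down up
    where
    valN≡0 : val N ≡ 0
    valN≡0 = subst (λ z → val z ≡ 0) first≡N val-first
    down : ∀ x → 1 ≤ x → x < 1 + N → 0 ≤ val x × val x < 0 + N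
    down x 1≤x x<n = z≤n , <-pred-≢ (val<n x<n) (val-≢ x<n z<s first≡N (λ x≡0 → <⇒≢ 1≤x (sym x≡0)))
    up : ∀ y → 0 ≤ y → y < 0 + N → 1 ≤ val y × val y < 1 + N
    up y _ y<N = n≢0⇒n>0 (val-≢ (<-trans y<N N<n) N<n valN≡0 (<⇒≢ y<N)) , val<n (<-trans y<N N<n)

  last≢0 : last ≢ 0
  last≢0 last≡0 = interval-absurd 0 N 1 (n≤1+n N) ≤-refl 2≤N N<n up down
    where
    val0≡N : val 0 ≡ N
    val0≡N = subst (λ z → val z ≡ N) last≡0 val-last
    up : ∀ x → 0 ≤ x → x < 0 + N → 1 ≤ val x × val x < 1 + N
    up x _ x<N = n≢0⇒n>0 (val-≢ (<-trans x<N N<n) N<n last≡0 (<⇒≢ x<N)) , val<n (<-trans x<N N<n)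
    down : ∀ y → 1 ≤ y → y < 1 + N → 0 ≤ val y × val y < 0 + N
    down y 1≤y y<n = z≤n , <-pred-≢ (val<n y<n) (val-≢ y<n z<s val0≡N (λ y≡0 → <⇒≢ 1≤y (sym y≡0)))

  first≮last : ¬ (first < last)
  first≮last first<last with argmax val first
  ... | i , i≤first , max =
    interval-absurd 0 (suc M) 0 (s≤s M≤N) (s≤s M≤N) (s≤s 1≤M) (s≤s M<N) closed closed
    where
    M : ℕ
    M = val i
    i<n : i < n
    i<n = ≤-<-trans i≤first first<n
    first≤M : first ≤ M
    first≤M = max z≤n
    i<first : i < first
    i<first = ≤∧≢⇒< i≤first (λ i≡first → first≢0 (n≤0⇒n≡0 (subst (first ≤_) (trans (cong val i≡first) val-first) first≤M)))
    M<N : M < N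
    M<N = <-pred-≢ (val<n i<n) (λ M≡N → <-irrefl (sym (val-swap i<n M≡N)) (<-trans i<first first<last))
    M≤N : M ≤ N
    M≤N = <⇒≤ M<N
    1≤M : 1 ≤ M
    1≤M = ≤-trans (n≢0⇒n>0 first≢0) first≤M
    valM : val M ≡ i
    valM = val-swap i<n refl
    below : ∀ {x} → x ≤ M → val x ≤ M
    below {x} x≤M with x ≤? first
    ... | yes x≤first = max x≤first
    ... | no x≰first with val x ≤? M
    ...   | yes vx≤M = vx≤M
    ...   | no vx≰M = ⊥-elim (no-2341 0<i (<-trans i<first first<x) x<M (s≤s M≤N) (valM ≡< i<first) first<M (≰⇒> vx≰M))
      where
      first<x : first < x
      first<x = ≰⇒> x≰first
      x<M : x < M
      x<M = ≤∧≢⇒< x≤M (λ x≡M → <-irrefl refl (<-≤-trans (≰⇒> vx≰M) (subst (_≤ M) (sym (trans (cong val x≡M) valM)) (≤-trans i≤first first≤M))))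
      0<i : 0 < i
      0<i = n≢0⇒n>0 (λ i≡0 → <-irrefl refl (<-trans first<x (<-≤-trans x<M (≤-reflexive (cong val i≡0)))))
      first<M : first < M
      first<M = ≤∧≢⇒< first≤M (λ first≡M → <⇒≢ 0<i (val-injective z<s i<n first≡M))
    closed : ∀ x → 0 ≤ x → x < 0 + suc M → 0 ≤ val x × val x < 0 + suc M
    closed x _ x≤M = z≤n , s≤s (below (m<1+n⇒m≤n x≤M))

  last<first : last < first
  last<first with <-cmp last first
  ... | tri< last<first _ _ = last<first
  ... | tri≈ _ last≡first _ = ⊥-elim (<⇒≢ (≤-trans (s≤s z≤n) 2≤N) (val-injective z<s N<n (sym last≡first)))
  ... | tri> _ _ first<last = ⊥-elim (first≮last first<last)

  0<last : 0 < last
  0<last = n≢0⇒n>0 last≢0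

  first<N : first < N
  first<N = <-pred-≢ first<n first≢N

  last<N : last < N
  last<N = <-trans last<first first<N

  InA InB InC Inner : ℕ → Set
  InA x = 0 < x × x < last
  InB x = last < x × x < first
  InC x = first < x × x < N
  Inner x = InA x ⊎ InB x ⊎ InC x

  inner<n : ∀ {x} → Inner x → x < n
  inner<n (inj₁ (_ , x<last)) = <-trans x<last last<n
  inner<n (inj₂ (inj₁ (_ , x<first))) = <-trans x<first first<n
  inner<n (inj₂ (inj₂ (_ , x<N))) = <-trans x<N N<n

  inner-≢ : ∀ {x} → Inner x → x ≢ 0 × x ≢ last × x ≢ first × x ≢ N
  inner-≢ (inj₁ (0<x , x<last)) =
    (λ e → <⇒≢ 0<x (sym e)) , <⇒≢ x<last , <⇒≢ (<-trans x<last last<first) , <⇒≢ (<-trans x<last last<N)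
  inner-≢ (inj₂ (inj₁ (last<x , x<first))) =
    (λ e → <⇒≢ (<-trans 0<last last<x) (sym e)) , (λ e → <⇒≢ last<x (sym e)) , <⇒≢ x<first , <⇒≢ (<-trans x<first first<N)
  inner-≢ (inj₂ (inj₂ (first<x , x<N))) =
    (λ e → <⇒≢ (<-trans (<-trans 0<last last<first) first<x) (sym e)) ,
    (λ e → <⇒≢ (<-trans last<first first<x) (sym e)) , (λ e → <⇒≢ first<x (sym e)) , <⇒≢ x<N

  inner-of-≢ : ∀ {v} → v < n → v ≢ 0 → v ≢ last → v ≢ first → v ≢ N → Inner v
  inner-of-≢ {v} v<n v≢0 v≢last v≢first v≢N with <-cmp v last
  ... | tri< v<last _ _ = inj₁ (n≢0⇒n>0 v≢0 , v<last)
  ... | tri≈ _ v≡last _ = ⊥-elim (v≢last v≡last)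
  ... | tri> _ _ last<v with <-cmp v first
  ...   | tri< v<first _ _ = inj₂ (inj₁ (last<v , v<first))
  ...   | tri≈ _ v≡first _ = ⊥-elim (v≢first v≡first)
  ...   | tri> _ _ first<v = inj₂ (inj₂ (first<v , <-pred-≢ v<n v≢N))

  inner-closed : ∀ {x} → Inner x → Inner (val x)
  inner-closed {x} x-inner with inner-≢ x-inner
  ... | x≢0 , x≢last , x≢first , x≢N = inner-of-≢ (val<n x<n)
        (λ e → x≢first (sym (val-swap x<n e)))
        (λ e → x≢N (trans (sym (val-swap x<n e)) val-last))
        (λ e → x≢0 (trans (sym (val-swap x<n e)) val-first))
        (λ e → x≢last (sym (val-swap x<n e)))
    where x<n = inner<n x-inner

ρ : ℕ → ℕ
ρ 0 = 4
ρ 1 = 1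
ρ 2 = 6
ρ 3 = 3
ρ 4 = 0
ρ 5 = 5
ρ 6 = 2
ρ _ = 0

module Occurrence123 {N : ℕ} (π : Perm (suc N)) (inv : IsInvolution π) (av : Avoids π σ2341)
    (simp : IsSimple π) {i j k : ℕ} (i<j : i < j) (j<k : j < k) (k<n : k < suc N)
    (vi<vj : Values.val π i < Values.val π j) (vj<vk : Values.val π j < Values.val π k) where
  open SimpleAvoider π inv av simp (≤-trans (s≤s (≤-<-trans z≤n i<j)) (≤-trans j<k (m<1+n⇒m≤n k<n))) public

  j<n : j < n
  j<n = <-trans j<k k<n
  i<n : i < n
  i<n = <-trans i<j j<n

  0<vj : 0 < val j
  0<vj = ≤-<-trans z≤n vi<vj

  0<vk : 0 < val k
  0<vk = <-trans 0<vj vj<vk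

  first<k : first < k
  first<k with <-cmp k first
  ... | tri< k<first _ _ = ⊥-elim (no-2341 i<j j<k k<first first<n (val-first ≡< 0<vi) vi<vj vj<vk)
    where
    0<vi : 0 < val i
    0<vi = n≢0⇒n>0 (λ vi≡0 → <⇒≢ (<-trans i<j (<-trans j<k k<first)) (sym (val-swap i<n vi≡0)))
  ... | tri≈ _ k≡first _ = ⊥-elim (<⇒≢ 0<vk (sym (trans (cong val k≡first) val-first)))
  ... | tri> _ _ first<k = first<k

  first<vk : first < val k
  first<vk with <-cmp (val k) first
  ... | tri< vk<first _ _ = ⊥-elim (no-4123 0<i i<j j<k k<n vi<vj vj<vk vk<first)
    where
    0<i : 0 < i
    0<i = n≢0⇒n>0 (λ i≡0 → <-irrefl refl (<-trans (subst (λ z → val z < val j) i≡0 vi<vj) (<-trans vj<vk vk<first)))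
  ... | tri≈ _ vk≡first _ = ⊥-elim (<⇒≢ (<-trans (≤-<-trans z≤n i<j) j<k) (trans (sym val-first) (val-swap k<n vk≡first)))
  ... | tri> _ _ first<vk = first<vk

  k<N : k < N
  k<N = <-pred-≢ k<n (λ k≡N → <-irrefl refl (<-trans (subst (λ z → val z < first) (sym k≡N) last<first) first<vk))

  vk<N : val k < N
  vk<N = <-pred-≢ (val<n k<n) (λ vk≡N → <-irrefl refl (<-trans (subst (_< first) (val-swap k<n vk≡N) last<first) first<k))

  i<last : i < last
  i<last with <-cmp i last
  ... | tri< i<last _ _ = i<last
  ... | tri≈ _ i≡last _ =
    ⊥-elim (<-irrefl refl (<-trans (subst (_< val k) val-last (subst (λ z → val z < val k) i≡last (<-trans vi<vj vj<vk))) vk<N))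
  ... | tri> _ _ last<i = ⊥-elim (no-4123 last<i i<j j<k k<n vi<vj vj<vk (vk<N <≡ val-last))

  vi<last : val i < last
  vi<last with <-cmp (val i) last
  ... | tri< vi<last _ _ = vi<last
  ... | tri≈ _ vi≡last _ = ⊥-elim (<⇒≢ (<-trans i<j (<-trans j<k k<N)) (trans (sym (val-swap i<n vi≡last)) val-last))
  ... | tri> _ _ last<vi = ⊥-elim (no-2341 i<j j<k k<N N<n last<vi vi<vj vj<vk)

  0<i : 0 < i
  0<i = n≢0⇒n>0 (λ i≡0 → <-irrefl refl (<-trans (subst (λ z → val z < last) i≡0 vi<last) last<first))

  0<vi : 0 < val i
  0<vi = n≢0⇒n>0 (λ vi≡0 → <⇒≢ (<-trans i<last last<first) (sym (val-swap i<n vi≡0)))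

  A↛C : ∀ {x} → InA x → ¬ InC (val x)
  A↛C (0<x , x<last) (first<vx , vx<N) =
    no-2341 0<x x<last last<first first<n (val-first ≡< n≢0⇒n>0 first≢0) first<vx (vx<N <≡ val-last)

  -- Unless val 1 + 1 = first (an interval of size 2), look at the position u = first - 1.
  val1∉B : ¬ InB (val 1)
  val1∉B (last<p , p<first) with <-cmp (suc (val 1)) first
  ... | tri≈ _ 1+p≡first _ =
    no-adjacent-swap 0 (val 1) 1<n (s≤s (subst (_≤ N) (sym 1+p≡first) (<⇒≤ first<N))) (sym 1+p≡first) refl
  ... | tri> _ _ first<1+p = <-irrefl refl (<-≤-trans p<first (m<1+n⇒m≤n first<1+p))
  ... | tri< 1+p<first _ _ = by-val-u (inner-closed (inj₂ (inj₁ (<-trans last<p p<u , u<first))))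
    where
    p : ℕ
    p = val 1
    u : ℕ
    u = pred first
    1+u≡first : suc u ≡ first
    1+u≡first = suc-pred first {{>-nonZero (<-trans 0<last last<first)}}
    vp≡1 : val p ≡ 1
    vp≡1 = val-swap 1<n refl
    p<u : p < u
    p<u = m<1+n⇒m≤n (1+p<first <≡ 1+u≡first)
    u<first : u < first
    u<first = subst (u <_) 1+u≡first ≤-refl
    u<n : u < n
    u<n = <-trans u<first first<n
    q : ℕ
    q = val u
    q≢1 : q ≢ 1
    q≢1 q≡1 = <⇒≢ p<u (val-swap u<n q≡1)
    0<p : 0 < p
    0<p = <-trans 0<last last<p
    by-val-u : Inner q → ⊥
    by-val-u (inj₁ (0<q , q<last)) =
      no-4123 0<p p<u (<-trans u<first first<N) N<n (vp≡1 ≡< ≤∧≢⇒< 0<q (q≢1 ∘ sym)) q<last last<first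
    by-val-u (inj₂ (inj₁ (last<q , q<first))) =
      no-4123 last<p p<u (<-trans u<first first<k) k<n (vp≡1 ≡< ≤-<-trans 0<last last<q) (<-trans q<first first<vk) (vk<N <≡ val-last)
    by-val-u (inj₂ (inj₂ (first<q , q<N))) with <-cmp (val k) q
    ... | tri> _ _ q<vk =
      no-4123 last<p p<u (<-trans u<first first<k) k<n (vp≡1 ≡< ≤-<-trans 0<last (<-trans last<first first<q)) q<vk (vk<N <≡ val-last)
    ... | tri≈ _ vk≡q _ = <-irrefl (sym (val-injective k<n u<n vk≡q)) (<-trans u<first first<k)
    ... | tri< vk<q _ _ with <-cmp j u
    ...   | tri< j<u _ _ = no-2341 i<j j<u u<first first<n (val-first ≡< 0<vi) vi<vj (<-trans vj<vk vk<q)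
    ...   | tri≈ _ j≡u _ = <-irrefl refl (<-trans (subst (λ z → val z < val k) j≡u vj<vk) vk<q)
    ...   | tri> _ _ u<j with <-cmp j first
    ...     | tri< j<first _ _ = <-irrefl refl (<-≤-trans j<first (subst (_≤ j) 1+u≡first u<j))
    ...     | tri≈ _ j≡first _ = <-irrefl refl (<-trans (subst (λ z → val i < val z) j≡first vi<vj) (val-first ≡< 0<vi))
    ...     | tri> _ _ first<j = no-4123 u<first first<j j<k k<n (val-first ≡< 0<vj) vj<vk vk<q

  A-closed : ∀ {x} → InA x → InA (val x)
  A-closed {x} x∈A@(0<x , x<last) with inner-closed (inj₁ x∈A)
  ... | inj₁ vx∈A = vx∈A
  ... | inj₂ (inj₂ vx∈C) = ⊥-elim (A↛C x∈A vx∈C)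
  ... | inj₂ (inj₁ (last<vx , vx<first)) with <-cmp 1 x
  ...   | tri≈ _ 1≡x _ = ⊥-elim (val1∉B (subst (InB ∘ val) (sym 1≡x) (last<vx , vx<first)))
  ...   | tri> _ _ x<1 = ⊥-elim (<-irrefl refl (<-≤-trans 0<x (m<1+n⇒m≤n x<1)))
  ...   | tri< 1<x _ _ with inner-closed (inj₁ (z<s , <-trans 1<x x<last))
  ...     | inj₁ (0<v1 , v1<last) = ⊥-elim (no-2341 1<x x<last last<first first<n
                                      (val-first ≡< 0<v1) (<-trans v1<last last<vx) (<-trans vx<first first<N <≡ val-last))
  ...     | inj₂ (inj₁ v1∈B) = ⊥-elim (val1∉B v1∈B)
  ...     | inj₂ (inj₂ v1∈C) = ⊥-elim (A↛C (z<s , <-trans 1<x x<last) v1∈C)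

  1+pred-N : suc (pred N) ≡ N
  1+pred-N = suc-pred N {{>-nonZero (<-trans 0<last last<N)}}

  pred-N<N : pred N < N
  pred-N<N = subst (pred N <_) 1+pred-N ≤-refl

  val²-pred-N : val (val (pred N)) ≡ pred N
  val²-pred-N = val-involutive (<-trans pred-N<N N<n)

  pred-N-valued-in-B : ∀ {x} → InB x → InC (val x) → ∃ λ q → InB q × val q ≡ pred N
  pred-N-valued-in-B {x} x∈B (first<vx , vx<N) with <-cmp (val x) (pred N)
  ... | tri≈ _ vx≡w _ = x , x∈B , vx≡w
  ... | tri> _ _ w<vx = ⊥-elim (<-irrefl refl (<-≤-trans w<vx (m<1+n⇒m≤n (vx<N <≡ 1+pred-N))))
  ... | tri< vx<w _ _ = by-val-w (inner-closed (inj₂ (inj₂ (first<w , pred-N<N))))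
    where
    first<w : first < pred N
    first<w = <-trans first<vx vx<w
    by-val-w : Inner (val (pred N)) → ∃ λ q → InB q × val q ≡ pred N
    by-val-w (inj₁ vw∈A) = ⊥-elim (A↛C vw∈A (first<w <≡ val²-pred-N , val²-pred-N ≡< pred-N<N))
    by-val-w (inj₂ (inj₁ vw∈B)) = val (pred N) , vw∈B , val²-pred-N
    by-val-w (inj₂ (inj₂ (first<vw , vw<N))) =
      ⊥-elim (no-2341 (<-trans 0<last (proj₁ x∈B)) (<-trans (proj₂ x∈B) first<vw) vw<N N<n
                last<first first<vx (vx<w <≡ val²-pred-N))

  -- Analyse val (last + 1), using the position q ∈ B with val q = N - 1.
  B↛C : ∀ {x} → InB x → ¬ InC (val x)
  B↛C x∈B vx∈C with pred-N-valued-in-B x∈B vx∈C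
  ... | q , (last<q , q<first) , vq≡w = by-val-1+last (inner-closed (inj₂ (inj₁ (≤-refl , 1+last<first))))
    where
    1+last<first : suc last < first
    1+last<first = ≤-<-trans (proj₁ x∈B) (proj₂ x∈B)
    1+last<n : suc last < n
    1+last<n = <-trans 1+last<first first<n
    first<w : first < pred N
    first<w = <-≤-trans (proj₁ vx∈C) (m<1+n⇒m≤n (proj₂ vx∈C <≡ 1+pred-N))
    by-val-1+last : Inner (val (suc last)) → ⊥
    by-val-1+last (inj₁ v∈A) = 1+n≰n (<⇒≤ (subst (_< last) (val-swap 1+last<n refl) (proj₂ (A-closed v∈A))))
    by-val-1+last (inj₂ (inj₁ (last<v , v<first))) =
      no-2341 (<-trans i<last (n<1+n last)) 1+last<q q<first first<n
        (val-first ≡< 0<vi) (<-trans vi<last last<v) (<-trans v<first first<w <≡ vq≡w)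
      where
      1+last<q : suc last < q
      1+last<q = ≤∧≢⇒< last<q (λ 1+last≡q → <-irrefl refl (<-trans (subst (λ z → val z < first) 1+last≡q v<first) (first<w <≡ vq≡w)))
    by-val-1+last (inj₂ (inj₂ (first<v , v<N))) with <-cmp (val (suc last)) (pred N)
    ... | tri≈ _ v≡w _ = no-adjacent-swap last (pred N) (s≤s (<⇒≤ (<-trans 1+last<first first<N)))
                           (s≤s (≤-reflexive 1+pred-N)) (trans val-last (sym 1+pred-N)) v≡w
    ... | tri> _ _ w<v = <-irrefl refl (<-≤-trans w<v (m<1+n⇒m≤n (v<N <≡ 1+pred-N)))
    ... | tri< v<w _ _ = no-2341 z<s 1+last<q q<first first<n (val-first ≡< n≢0⇒n>0 first≢0) first<v (v<w <≡ vq≡w)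
      where
      1+last<q : suc last < q
      1+last<q = ≤∧≢⇒< last<q (λ 1+last≡q → <-irrefl (cong val 1+last≡q) (v<w <≡ vq≡w))

  B-closed : ∀ {x} → InB x → InB (val x)
  B-closed {x} x∈B with inner-closed (inj₂ (inj₁ x∈B))
  ... | inj₁ vx∈A = ⊥-elim (<-asym (proj₁ x∈B) (sym (val-involutive x<n) ≡< proj₂ (A-closed vx∈A)))
    where x<n = <-trans (proj₂ x∈B) first<n
  ... | inj₂ (inj₁ vx∈B) = vx∈B
  ... | inj₂ (inj₂ vx∈C) = ⊥-elim (B↛C x∈B vx∈C)

  C-closed : ∀ {x} → InC x → InC (val x)
  C-closed {x} x∈C with inner-closed (inj₂ (inj₂ x∈C))
  ... | inj₁ vx∈A = ⊥-elim (<-asym (<-trans last<first (proj₁ x∈C)) (sym (val-involutive x<n) ≡< proj₂ (A-closed vx∈A)))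
    where x<n = <-trans (proj₂ x∈C) N<n
  ... | inj₂ (inj₁ vx∈B) = ⊥-elim (<-asym (proj₁ x∈C) (sym (val-involutive x<n) ≡< proj₂ (B-closed vx∈B)))
    where x<n = <-trans (proj₂ x∈C) N<n
  ... | inj₂ (inj₂ vx∈C) = vx∈C

  -- Each block is closed under val, so it holds at most one position.
  last≡2 : last ≡ 2
  last≡2 = ≮1+⇒≡1+ (≤-<-trans 0<i i<last) (closed-block-absurd 0 last (<⇒≤ last<N) A-closed z<s ≤-refl)

  k≡1+first : k ≡ suc first
  k≡1+first = ≮1+⇒≡1+ first<k (λ 1+first<k → closed-block-absurd first N ≤-refl C-closed ≤-refl 1+first<k k<N)

  j<first : j < first
  j<first = ≤∧≢⇒< (m<1+n⇒m≤n (j<k <≡ sym k≡1+first)) (λ j≡first → <⇒≢ 0<vj (sym (trans (cong val j≡first) val-first)))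

  j≡1+last : j ≡ suc last
  j≡1+last = ≮1+⇒≡1+ last<j (λ 1+last<j → closed-block-absurd last first (<⇒≤ first<N) B-closed ≤-refl 1+last<j j<first)
    where
    last<j : last < j
    last<j = ≤∧≢⇒< (subst (_≤ j) (sym last≡2) (≤-trans (s≤s 0<i) i<j))
               (λ last≡j → <-irrefl refl (<-trans (subst (_< val k) (subst (λ z → val z ≡ N) last≡j val-last) vj<vk) vk<N))

  first≡1+j : first ≡ suc j
  first≡1+j = ≮1+⇒≡1+ j<first (closed-block-absurd last first (<⇒≤ first<N) B-closed (≤-refl <≡ j≡1+last) ≤-refl)

  N≡1+k : N ≡ suc k
  N≡1+k = ≮1+⇒≡1+ k<N (closed-block-absurd first N ≤-refl C-closed first<k ≤-refl)

  first≡4 : first ≡ 4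
  first≡4 = trans first≡1+j (cong suc (trans j≡1+last (cong suc last≡2)))

  N≡6 : N ≡ 6
  N≡6 = trans N≡1+k (cong suc (trans k≡1+first (cong suc first≡4)))

  val≡ρ : ∀ {x} → x < 7 → val x ≡ ρ x
  val≡ρ {0} _ = first≡4
  val≡ρ {1} _ = squeeze (proj₁ v∈A) (proj₂ v∈A <≡ sym last≡2)
    where v∈A = A-closed (z<s , ≤-refl <≡ last≡2)
  val≡ρ {2} _ = trans (cong val (sym last≡2)) (trans val-last N≡6)
  val≡ρ {3} _ = squeeze (sym last≡2 ≡< proj₁ v∈B) (proj₂ v∈B <≡ sym first≡4)
    where v∈B = B-closed (last≡2 ≡< ≤-refl , ≤-refl <≡ first≡4)
  val≡ρ {4} _ = trans (cong val (sym first≡4)) val-first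
  val≡ρ {5} _ = squeeze (sym first≡4 ≡< proj₁ v∈C) (proj₂ v∈C <≡ sym N≡6)
    where v∈C = C-closed (first≡4 ≡< ≤-refl , ≤-refl <≡ N≡6)
  val≡ρ {6} _ = trans (cong val (sym N≡6)) last≡2
  val≡ρ {suc (suc (suc (suc (suc (suc (suc _))))))} (s≤s (s≤s (s≤s (s≤s (s≤s (s≤s (s≤s ())))))))

ρ-involutive : ∀ {x} → x < 7 → ρ (ρ x) ≡ x
ρ-involutive = toWitness {a? = allUpTo? (λ x → ρ (ρ x) ≟ x) 7} _

ρ-avoids2341 : ¬ Occurs2341 ρ 7
ρ-avoids2341 = toWitnessFalse {a? = occurs2341? ρ 7} _

ρ-no-interval : ∀ {a} → a < 7 → ∀ {m} → m < 7 → ∀ {b} → b < 7 → 2 ≤ m → a + m ≤ 7 →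
                ¬ (∀ {x} → x < a + m → a ≤ x → b ≤ ρ x × ρ x < b + m)
ρ-no-interval = toWitness {a? = allUpTo? (λ a → allUpTo? (λ m → allUpTo? (λ b →
  (2 ≤? m) →-dec ((a + m ≤? 7) →-dec ¬? (allUpTo? (λ x →
    (a ≤? x) →-dec ((b ≤? ρ x) ×-dec (ρ x <? b + m))) (a + m)))) 7) 7) 7} _

module _ (π : Perm 7) where
  open Values π

  oneLine⇔val≡ρ : oneLine π ≡ 5 ∷ 2 ∷ 7 ∷ 4 ∷ 1 ∷ 6 ∷ 3 ∷ [] ⇔ (∀ {x} → x < 7 → val x ≡ ρ x)
  oneLine⇔val≡ρ = mk⇔ to from
    where
    to : oneLine π ≡ 5 ∷ 2 ∷ 7 ∷ 4 ∷ 1 ∷ 6 ∷ 3 ∷ [] → ∀ {x} → x < 7 → val x ≡ ρ x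
    to eq {x} x<7 = begin
      val x                     ≡⟨ sym (val-fromℕ< x<7) ⟩
      toℕ (π ⟨ fromℕ< x<7 ⟩)    ≡⟨ suc-injective (entries (fromℕ< x<7)) ⟩
      ρ (toℕ (fromℕ< x<7))      ≡⟨ cong ρ (toℕ-fromℕ< x<7) ⟩
      ρ x                       ∎
      where
      open ≡-Reasoning
      entries : ∀ i → suc (toℕ (π ⟨ i ⟩)) ≡ suc (ρ (toℕ i))
      entries = tabulate-injective {g = suc ∘ ρ ∘ toℕ} (trans (sym oneLine-tabulate) eq)
    from : (∀ {x} → x < 7 → val x ≡ ρ x) → oneLine π ≡ 5 ∷ 2 ∷ 7 ∷ 4 ∷ 1 ∷ 6 ∷ 3 ∷ []
    from val≡ρ = trans oneLine-tabulate (tabulate-cong λ i → cong suc (trans (sym (val-toℕ i)) (val≡ρ (toℕ<n i))))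

module WithValuesρ (π : Perm 7) (val≡ρ : ∀ {x} → x < 7 → Values.val π x ≡ ρ x) where
  open Values π

  involution : IsInvolution π
  involution i = toℕ-injective (begin
    toℕ (π ⟨ π ⟨ i ⟩ ⟩)       ≡⟨ sym (val-toℕ (π ⟨ i ⟩)) ⟩
    val (toℕ (π ⟨ i ⟩))       ≡⟨ cong val (sym (val-toℕ i)) ⟩
    val (val (toℕ i))         ≡⟨ val≡ρ (val<n (toℕ<n i)) ⟩
    ρ (val (toℕ i))           ≡⟨ cong ρ (val≡ρ (toℕ<n i)) ⟩
    ρ (ρ (toℕ i))             ≡⟨ ρ-involutive (toℕ<n i) ⟩
    toℕ i                     ∎)
    where open ≡-Reasoning

  avoids2341 : Avoids π σ2341
  avoids2341 = ρ-avoids2341 ∘ occurs2341-cong val≡ρ ∘ Equivalence.to contains2341⇔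

  simple : IsSimple π
  simple = s≤s (s≤s z≤n) , no-interval
    where
    no-interval : ∀ a m → IsInterval π a m → 2 ≤ m → m < 7 → ⊥
    no-interval a m I 2≤m m<7 with interval-values I
    ... | b , inside = ρ-no-interval a<7 m<7 b<7 2≤m a+m≤7 λ x<a+m a≤x →
                         subst (λ v → b ≤ v × v < b + m) (val≡ρ (<-≤-trans x<a+m a+m≤7)) (inside x<a+m a≤x)
      where
      a+m≤7 : a + m ≤ 7
      a+m≤7 = proj₁ I
      a<a+m : a < a + m
      a<a+m = m<m+n a (≤-trans (s≤s z≤n) 2≤m)
      a<7 : a < 7
      a<7 = <-≤-trans a<a+m a+m≤7
      b<7 : b < 7
      b<7 = ≤-<-trans (proj₁ (inside a<a+m ≤-refl)) (val<n a<7)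

at-length-7 : ∀ {N} (π : Perm (suc N)) → N ≡ 6 → (∀ {x} → x < 7 → Values.val π x ≡ ρ x) →
              oneLine π ≡ 5 ∷ 2 ∷ 7 ∷ 4 ∷ 1 ∷ 6 ∷ 3 ∷ []
at-length-7 π refl = Equivalence.from (oneLine⇔val≡ρ π)

containing123⇒5274163 : ∀ {n} (π : Perm n) → IsInvolution π → Avoids π σ2341 → IsSimple π →
                        Occurs123 (Values.val π) n → oneLine π ≡ 5 ∷ 2 ∷ 7 ∷ 4 ∷ 1 ∷ 6 ∷ 3 ∷ []
containing123⇒5274163 {suc N} π inv av simp (k , k<n , j , j<k , i , i<j , vi<vj , vj<vk) = at-length-7 π N≡6 val≡ρ
  where open Occurrence123 π inv av simp i<j j<k k<n vi<vj vj<vk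

theorem6p1 : ∀ (n : ℕ) (π : Perm n) →
    (IsSimple π × IsInvolution π × Avoids π σ2341)
      ⇔ ((oneLine π ≡ 5 ∷ 2 ∷ 7 ∷ 4 ∷ 1 ∷ 6 ∷ 3 ∷ [])
          ⊎ (IsSimple π × IsInvolution π × Avoids π σ123))
theorem6p1 n π = mk⇔ forward backward
  where
  open Values π
  forward : IsSimple π × IsInvolution π × Avoids π σ2341 →
            oneLine π ≡ 5 ∷ 2 ∷ 7 ∷ 4 ∷ 1 ∷ 6 ∷ 3 ∷ [] ⊎ (IsSimple π × IsInvolution π × Avoids π σ123)
  forward (simp , inv , av) with occurs123? val n
  ... | yes occ = inj₁ (containing123⇒5274163 π inv av simp occ)
  ... | no ¬occ = inj₂ (simp , inv , ¬occ ∘ Equivalence.to contains123⇔)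
  backward : oneLine π ≡ 5 ∷ 2 ∷ 7 ∷ 4 ∷ 1 ∷ 6 ∷ 3 ∷ [] ⊎ (IsSimple π × IsInvolution π × Avoids π σ123) →
             IsSimple π × IsInvolution π × Avoids π σ2341
  backward (inj₁ eq) with trans (sym length-oneLine) (cong length eq)
  ... | refl = simple , involution , avoids2341
    where open WithValuesρ π (Equivalence.to (oneLine⇔val≡ρ π) eq)
  backward (inj₂ (simp , inv , av123)) = simp , inv , avoids123⇒avoids2341 π av123
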